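{- Let $D=(V,A)$ be a finite, connected, acyclic digraph with a U-coloring $c$, and suppose $D$ has a unique sink $s$. If $p$ and $p'$ are directed paths from $x$ to $z$ in $D$, then $c(p)=c(p')$. In particular, the colorset $c(x)$ of a vertex $x$, defined as the colorset of any directed $(x,s)$-path, is well defined.
   Context: For a digraph $D=(V,A)$, an arc coloring $c$ is a U-coloring if for all $u,v,w\in V$ with $u\neq w$ and $(v,u),(v,w)\in A$: (U$_1$) $c(v,u)\neq c(v,w)$; (U$_2$) there is $z\in V$ with arcs $(u,z),(w,z)\in A$ such that $c(v,u)=c(w,z)$ and $c(v,w)=c(u,z)$. The colorset $c(p)$ of a directed path $p$ is the multiset of colors of its arcs. -}

module Defs where

open import Level using (Level; _⊔_) renaming (suc to lsuc)
open import Data.Nat using (ℕ; suc)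
open import Data.Fin using (Fin)
open import Data.List using (List; []; _∷_)
open import Data.List.Relation.Unary.Unique.Propositional using (Unique)
open import Data.List.Relation.Binary.Permutation.Propositional using (_↭_)
open import Data.Product using (Σ; ∃; _×_; _,_)
open import Data.Sum using (_⊎_)
open import Data.Empty using (⊥)
open import Relation.Nullary using (¬_)
open import Relation.Binary.PropositionalEquality using (_≡_; _≢_)

-- A digraph on the finite vertex set V = Fin n is given by its arc relation
-- A u v  ("(u,v) is an arc").  An arc colouring assigns a colour in C to
-- each ordered pair (only its values on arcs matter).

Digraph : ℕ → Set₁
Digraph n = Fin n → Fin n → Set

data Walk {n : ℕ} (A : Digraph n) : Fin n → Fin n → Set where
  []  : ∀ {x} → Walk A x x
  _∷_ : ∀ {x y z} → A x y → Walk A y z → Walk A x z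

vertices : ∀ {n} {A : Digraph n} {x z} → Walk A x z → List (Fin n)
vertices {x = x} []       = x ∷ []
vertices {x = x} (_ ∷ w)  = x ∷ vertices w

len : ∀ {n} {A : Digraph n} {x z} → Walk A x z → ℕ
len []      = 0
len (_ ∷ w) = suc (len w)

record Path {n : ℕ} (A : Digraph n) (x z : Fin n) : Set where
  constructor path
  field
    walk     : Walk A x z
    distinct : Unique (vertices walk)

Cycle : ∀ {n} → Digraph n → Fin n → Set
Cycle A x = Σ _ λ y → Σ (A x y) λ _ → Σ (Walk A y x) λ w → Unique (vertices w)

Acyclic : ∀ {n} → Digraph n → Set
Acyclic {n} A = (x : Fin n) → ¬ Cycle A x

data UWalk {n : ℕ} (A : Digraph n) : Fin n → Fin n → Set where
  []  : ∀ {x} → UWalk A x x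
  _∷_ : ∀ {x y z} → (A x y ⊎ A y x) → UWalk A y z → UWalk A x z

Connected : ∀ {n} → Digraph n → Set
Connected {n} A = (x y : Fin n) → UWalk A x y

IsSink : ∀ {n} → Digraph n → Fin n → Set
IsSink {n} A s = (v : Fin n) → ¬ A s v

UniqueSink : ∀ {n} → Digraph n → Fin n → Set
UniqueSink {n} A s = IsSink A s × ((t : Fin n) → IsSink A t → t ≡ s)

IsUColoring : ∀ {n} {C : Set} → Digraph n → (Fin n → Fin n → C) → Set
IsUColoring {n} A c =
  ∀ (u v w : Fin n) → u ≢ w → A v u → A v w →
    (c v u ≢ c v w)
    × (Σ (Fin n) λ z → A u z × A w z × c v u ≡ c w z × c v w ≡ c u z)

-- colour list of a walk; colorsets are compared as multisets via _↭_
colors : ∀ {n} {C : Set} {A : Digraph n} → (Fin n → Fin n → C) →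
         ∀ {x z} → Walk A x z → List C
colors c []                = []
colors c (_∷_ {x} {y} _ w) = c x y ∷ colors c w

colorset : ∀ {n} {C : Set} {A : Digraph n} → (Fin n → Fin n → C) →
           ∀ {x z} → Path A x z → List C
colorset c p = colors c (Path.walk p)

-- A U-colouring lets two walks to the sink that leave x along different arcs
-- (x,u) and (x,w) be rerouted through a common vertex z with u → z and w → z,
-- and the colour condition of U₂ makes the two reroutings start with the same
-- pair of colours in swapped order.  Hence, by induction on length, all walks
-- from a vertex to the sink s have the same colour multiset (and the same
-- length).  In a connected digraph every vertex reaches s, because by U₂ a walk
-- u ⇝ s yields one from every out-neighbour of u; so two paths x ⇝ z, both
-- extended by one fixed walk z ⇝ s, have equal colour multisets, and the
-- common suffix cancels.
module Submission where

open import Defs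
open import Data.Nat using (ℕ; suc)
open import Data.Nat.Properties using (suc-injective)
open import Data.Fin using (Fin)
open import Data.Fin.Properties using (_≟_)
open import Data.List using (List; []; _∷_; _++_)
open import Data.List.Relation.Binary.Permutation.Propositional
  using (_↭_; ↭-refl; prep; swap; module PermutationReasoning)
open import Data.List.Relation.Binary.Permutation.Propositional.Properties
  using (drop-∷; ++-comm)
open import Data.Product using (Σ; _,_; proj₁; proj₂)
open import Data.Sum using (inj₁; inj₂)
open import Data.Empty using (⊥-elim)
open import Relation.Nullary using (yes; no)
open import Relation.Binary.PropositionalEquality using (_≡_; refl; cong; sym; trans)

infixr 5 _++ʷ_

_++ʷ_ : ∀ {n} {A : Digraph n} {x y z} → Walk A x y → Walk A y z → Walk A x z
[]      ++ʷ v = v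
(a ∷ w) ++ʷ v = a ∷ (w ++ʷ v)

colors-++ʷ : ∀ {n} {C : Set} {A : Digraph n} (c : Fin n → Fin n → C) {x y z}
             (w : Walk A x y) (v : Walk A y z) →
             colors c (w ++ʷ v) ≡ colors c w ++ colors c v
colors-++ʷ c []      v = refl
colors-++ʷ c (a ∷ w) v = cong (_ ∷_) (colors-++ʷ c w v)

↭-cancelˡ : ∀ {C : Set} (zs : List C) {xs ys : List C} → zs ++ xs ↭ zs ++ ys → xs ↭ ys
↭-cancelˡ []       zs++xs↭zs++ys = zs++xs↭zs++ys
↭-cancelˡ (z ∷ zs) zs++xs↭zs++ys = ↭-cancelˡ zs (drop-∷ zs++xs↭zs++ys)

↭-cancelʳ : ∀ {C : Set} (zs : List C) {xs ys : List C} → xs ++ zs ↭ ys ++ zs → xs ↭ ys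
↭-cancelʳ zs {xs} {ys} xs++zs↭ys++zs = ↭-cancelˡ zs (begin
  zs ++ xs  ↭⟨ ++-comm zs xs ⟩
  xs ++ zs  ↭⟨ xs++zs↭ys++zs ⟩
  ys ++ zs  ↭⟨ ++-comm ys zs ⟩
  zs ++ ys  ∎)
  where open PermutationReasoning

module _ {n : ℕ} {A : Digraph n} {C : Set} {c : Fin n → Fin n → C} {s : Fin n}
         (U : IsUColoring A c) (s-sink : IsSink A s) where

  successor-walkToSink : ∀ {u} (r : Walk A u s) {y} → A u y →
                         Σ (Walk A y s) λ q → suc (len q) ≡ len r
  successor-walkToSink []                       a = ⊥-elim (s-sink _ a)
  successor-walkToSink (_∷_ {y = v} b r) {y} a with y ≟ v
  ... | yes refl = r , refl
  ... | no y≢v with proj₂ (U y _ v y≢v a b)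
  ... | z , ayz , avz , _ , _ =
    let q , suc-len-q≡len-r = successor-walkToSink r avz
    in ayz ∷ q , cong suc suc-len-q≡len-r

  walkToSink : ∀ {x} → UWalk A x s → Walk A x s
  walkToSink []           = []
  walkToSink (inj₁ a ∷ w) = a ∷ walkToSink w
  walkToSink (inj₂ a ∷ w) = proj₁ (successor-walkToSink (walkToSink w) a)

  walksToSink-colors-↭ : ∀ {x} (p p′ : Walk A x s) → colors c p ↭ colors c p′
  walksToSink-colors-↭ p p′ = by-length (len p) p p′ refl
    where
    -- Induction on length rather than structure: the rerouted walks auz ∷ q
    -- and awz ∷ q are not subterms of p or p′.
    by-length : ∀ k {x} (p p′ : Walk A x s) → len p ≡ k → colors c p ↭ colors c p′
    by-length _ []      []       _ = ↭-refl
    by-length _ []      (b ∷ _)  _ = ⊥-elim (s-sink _ b)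
    by-length _ (a ∷ _) []       _ = ⊥-elim (s-sink _ a)
    by-length (suc k) {x} (_∷_ {y = u} a r) (_∷_ {y = w} b r′) 1+len-r≡1+k
      with u ≟ w | suc-injective 1+len-r≡1+k
    ... | yes refl | len-r≡k = prep (c x u) (by-length k r r′ len-r≡k)
    ... | no u≢w | len-r≡k with proj₂ (U u x w u≢w a b)
    ... | z , auz , awz , cxu≡cwz , cxw≡cuz =
      let q , suc-len-q≡len-r = successor-walkToSink r auz in
      begin
        c x u ∷ colors c r          ↭⟨ prep _ (by-length k r (auz ∷ q) len-r≡k) ⟩
        c x u ∷ c u z ∷ colors c q  ≡⟨ cong (λ t → c x u ∷ t ∷ colors c q) (sym cxw≡cuz) ⟩
        c x u ∷ c x w ∷ colors c q  ↭⟨ swap _ _ ↭-refl ⟩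
        c x w ∷ c x u ∷ colors c q  ≡⟨ cong (λ t → c x w ∷ t ∷ colors c q) cxu≡cwz ⟩
        c x w ∷ c w z ∷ colors c q  ↭⟨ prep _ (by-length k (awz ∷ q) r′ (trans suc-len-q≡len-r len-r≡k)) ⟩
        c x w ∷ colors c r′         ∎
      where open PermutationReasoning

proposition2 : (n : ℕ) (A : Digraph n) (C : Set) (c : Fin n → Fin n → C) (s : Fin n) →
    Connected A → Acyclic A → IsUColoring A c → UniqueSink A s →
    (x z : Fin n) (p p′ : Path A x z) → colorset c p ↭ colorset c p′
proposition2 n A C c s connected _ U (s-sink , _) x z p p′ =
  ↭-cancelʳ (colors c t) (begin
    colors c w ++ colors c t    ≡⟨ colors-++ʷ c w t ⟨
    colors c (w ++ʷ t)          ↭⟨ walksToSink-colors-↭ U s-sink (w ++ʷ t) (w′ ++ʷ t) ⟩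
    colors c (w′ ++ʷ t)         ≡⟨ colors-++ʷ c w′ t ⟩
    colors c w′ ++ colors c t   ∎)
  where
  open PermutationReasoning
  t : Walk A z s
  t = walkToSink U s-sink (connected z s)
  w w′ : Walk A x z
  w  = Path.walk p
  w′ = Path.walk p′
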